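{- For every odd integer $n \ge 7$, $$f_3(n) \ge \binom{n-1}{2} + \frac{n-1}{2}.$$
   Context: For integers $k\ge 2$ and $\ell \ge k+1$, the tight $k$-uniform $\ell$-cycle $TC_\ell^k$ is the $k$-uniform hypergraph on $\ell$ distinct vertices $v_0,\dots,v_{\ell-1}$ whose edges are all the $k$-sets $\{v_i,v_{i+1},\dots,v_{i+k-1}\}$, with subscripts modulo $\ell$. A $k$-uniform hypergraph is tight-cycle-free if it contains no subhypergraph isomorphic to $TC_\ell^k$ for any $\ell\ge k+1$. $f_k(n)$ denotes the maximum number of edges in a tight-cycle-free $k$-uniform hypergraph on $n$ vertices. -}

module Defs where

open import Data.Empty using (⊥)
open import Data.Nat using (ℕ; suc; _+_; _≤_)
open import Data.Fin using (Fin)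
open import Data.Fin.Subset using (Subset; _∈_; ∣_∣)
open import Data.List using (List; length)
open import Data.List.Relation.Unary.Unique.Propositional using (Unique)
import Data.List.Membership.Propositional as LM
open import Data.Product using (Σ; ∃; _×_; _,_)
open import Data.Sum using (_⊎_)
open import Function.Definitions using (Injective)
open import Function.Bundles using (_⇔_)
open import Relation.Binary.PropositionalEquality using (_≡_)
open import Data.Fin using (fromℕ<; toℕ)
open import Data.Nat.DivMod using (_%_; m%n<n)

record Hypergraph3 (n : ℕ) : Set where
  field
    edges     : List (Subset n)
    distinct  : Unique edges
    uniform   : ∀ {e} → e LM.∈ edges → ∣ e ∣ ≡ 3

open Hypergraph3 public

numEdges : ∀ {n} → Hypergraph3 n → ℕ
numEdges H = length (edges H)

HasEdge : ∀ {n} → Hypergraph3 n → Fin n → Fin n → Fin n → Set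
HasEdge {n} H x y z =
  Σ (Subset n) λ e → (e LM.∈ edges H) ×
    (∀ w → (w ∈ e) ⇔ (w ≡ x ⊎ w ≡ y ⊎ w ≡ z))

sucMod : ∀ {ℓ} → Fin ℓ → Fin ℓ
sucMod {suc ℓ} i = fromℕ< (m%n<n (suc (toℕ i)) (suc ℓ))

ContainsTightCycle : ∀ {n} → Hypergraph3 n → ℕ → Set
ContainsTightCycle {n} H ℓ =
  Σ (Fin ℓ → Fin n) λ v → Injective _≡_ _≡_ v ×
    (∀ i → HasEdge H (v i) (v (sucMod i)) (v (sucMod (sucMod i))))

TightCycleFree : ∀ {n} → Hypergraph3 n → Set
TightCycleFree H = ∀ ℓ → 4 ≤ ℓ → ContainsTightCycle H ℓ → ⊥

module Submission where

-- For odd n = 2m + 1 ≥ 7 (so m ≥ 3) we exhibit a tight-cycle-free 3-graph on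
-- n vertices with C(2m,2) + m edges.  The vertices are an apex together with
-- m blocks {⟨p,false⟩, ⟨p,true⟩}, p ∈ ℤ/m.  The edges are
--   * fans: the apex with any two vertices from different blocks, and
--   * ladders: a whole block p together with one vertex of block p + 1,
-- that is C(2m,2) − m + 2m edges; both families are enumerated by the 2m²
-- codes (p, q, b) ∈ ℤ/m × ℤ/m × Bool.
--
-- Along a tight cycle consecutive windows share two vertices, and a short
-- case analysis of how shapes may follow each other (closesAtApex) shows
-- that no run of windows can close up: neither one avoiding the apex
-- (noApexRun) nor one starting at the apex (apexRun).

open import Data.Bool using (Bool; true; false; not)
open import Data.Bool.Properties using (¬-not; not-¬; not-involutive)
open import Data.Empty using (⊥; ⊥-elim)
import Data.Fin as F
open import Data.Fin using (Fin; toℕ; fromℕ<; _↑ˡ_; _↑ʳ_; splitAt)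
  renaming (zero to fzero; suc to fsuc)
open import Data.Fin.Properties
  using (toℕ-fromℕ<; toℕ<n; splitAt-↑ˡ; splitAt-↑ʳ; splitAt⁻¹-↑ˡ; splitAt⁻¹-↑ʳ;
         _≟_; <-cmp; <-asym; any?; *↔×; 2↔Bool)
open import Data.Fin.Subset using (Subset; ⁅_⁆; _∪_; ∣_∣; inside; outside)
  renaming (_∈_ to _∈ₛ_; _∉_ to _∉ₛ_)
open import Data.Fin.Subset.Properties
  using (x∈⁅x⁆; x∈⁅y⁆⇒x≡y; x≢y⇒x∉⁅y⁆; x∈p∪q⁻; x∈p∪q⁺; ∣⁅x⁆∣≡1; ∪-identityˡ)
open import Data.List using (map; allFin)
open import Data.List.Properties using (length-map; length-tabulate)
open import Data.List.Membership.Propositional using () renaming (_∈_ to _∈ₗ_)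
open import Data.List.Membership.Propositional.Properties using (∈-map⁻)
open import Data.List.Relation.Unary.Unique.Propositional.Properties using (map⁺; allFin⁺)
open import Data.Nat using (ℕ; zero; suc; _+_; _*_; _∸_; _≤_; _<_; z≤n; s≤s; _<?_; NonZero)
open import Data.Nat.Properties
  using (<⇒≢; ≮⇒≥; +-monoˡ-<; ∸-monoˡ-<; m+n∸m≡n; <-trans; ≤-trans; ≤-reflexive; +-suc; *-cancelˡ-≡)
open import Data.Nat.Combinatorics using (_C_; nCk+nC[k+1]≡[n+1]C[k+1]; nC1≡n)
open import Data.Nat.Divisibility using (_∣_; divides)
open import Data.Nat.DivMod
open import Data.Nat.GeneralisedArithmetic using (fold)
open import Data.Nat.Tactic.RingSolver using (solve-∀)
open import Data.Product using (Σ; ∃; _×_; _,_; proj₁; proj₂)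
open import Data.Product.Function.NonDependent.Propositional using (_×-↔_)
open import Data.Sum using (_⊎_; inj₁; inj₂; [_,_]′)
open import Data.Vec.Base using (_∷_; here; there)
open import Function using (_∘_; Injective; Injection; Inverse; _↔_)
open import Function.Bundles using (Equivalence)
open import Function.Properties.Inverse using (↔-refl; ↔-trans; ↔⇒↣)
open import Relation.Binary using (Tri; tri<; tri≈; tri>)
open import Relation.Binary.PropositionalEquality
open import Relation.Nullary using (¬_; Dec; yes; no)

open import Defs

shift : ∀ {ℓ} → ℕ → Fin ℓ → Fin ℓ
shift k i = fold i sucMod k

toℕ-shift : ∀ {L} k (i : Fin (suc L)) → toℕ (shift k i) ≡ (k + toℕ i) % suc L
toℕ-shift zero i = sym (m<n⇒m%n≡m (toℕ<n i))
toℕ-shift {L} (suc k) i = begin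
  toℕ (sucMod (shift k i))                  ≡⟨ toℕ-fromℕ< (m%n<n (suc (toℕ (shift k i))) (suc L)) ⟩
  suc (toℕ (shift k i)) % suc L             ≡⟨ cong (λ x → suc x % suc L) (toℕ-shift k i) ⟩
  (1 + (k + toℕ i) % suc L) % suc L         ≡⟨ %-distribˡ-+ 1 ((k + toℕ i) % suc L) (suc L) ⟩
  (1 % suc L + (k + toℕ i) % suc L % suc L) % suc L
    ≡⟨ cong (λ x → (1 % suc L + x) % suc L) (m%n%n≡m%n (k + toℕ i) (suc L)) ⟩
  (1 % suc L + (k + toℕ i) % suc L) % suc L ≡⟨ sym (%-distribˡ-+ 1 (k + toℕ i) (suc L)) ⟩
  suc (k + toℕ i) % suc L                   ∎
  where open ≡-Reasoning

+-mod-≢ : ∀ {n k t} .{{_ : NonZero n}} → 0 < k → k < n → t < n → (k + t) % n ≢ t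
+-mod-≢ {n} {k} {t} 0<k k<n t<n eq with k + t <? n
... | yes k+t<n = <⇒≢ (+-monoˡ-< t 0<k) (sym (trans (sym (m<n⇒m%n≡m k+t<n)) eq))
... | no k+t≮n = <⇒≢ wrapped<t (trans (sym reduced) eq)
  where
  n≤k+t : n ≤ k + t
  n≤k+t = ≮⇒≥ k+t≮n
  wrapped<t : k + t ∸ n < t
  wrapped<t = subst (k + t ∸ n <_) (m+n∸m≡n n t) (∸-monoˡ-< (+-monoˡ-< t k<n) n≤k+t)
  reduced : (k + t) % n ≡ k + t ∸ n
  reduced = trans (sym (m≤n⇒[n∸m]%m≡n%m n≤k+t)) (m<n⇒m%n≡m (<-trans wrapped<t t<n))

shift-≢ : ∀ {ℓ} k (i : Fin ℓ) → 0 < k → k < ℓ → shift k i ≢ i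
shift-≢ {suc L} k i 0<k k<ℓ eq =
  +-mod-≢ 0<k k<ℓ (toℕ<n i) (trans (sym (toℕ-shift k i)) (cong toℕ eq))

_∈₃_ : {A : Set} → A → A × A × A → Set
x ∈₃ (a , b , c) = x ≡ a ⊎ x ≡ b ⊎ x ≡ c

_⊆₃_ : {A : Set} → A × A × A → A × A × A → Set
S ⊆₃ T = ∀ x → x ∈₃ S → x ∈₃ T

Distinct : {A : Set} → A × A × A → Set
Distinct (a , b , c) = a ≢ b × a ≢ c × b ≢ c

map₃ : {A B : Set} → (A → B) → A × A × A → B × B × B
map₃ f (a , b , c) = f a , f b , f c

∈₃-map : {A B : Set} (f : A → B) {x : A} (T : A × A × A) → x ∈₃ T → f x ∈₃ map₃ f T
∈₃-map f T (inj₁ refl) = inj₁ refl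
∈₃-map f T (inj₂ (inj₁ refl)) = inj₂ (inj₁ refl)
∈₃-map f T (inj₂ (inj₂ refl)) = inj₂ (inj₂ refl)

set₃ : ∀ {n} → Fin n × Fin n × Fin n → Subset n
set₃ (a , b , c) = ⁅ a ⁆ ∪ ⁅ b ⁆ ∪ ⁅ c ⁆

∈set₃⁺ : ∀ {n} (T : Fin n × Fin n × Fin n) {x} → x ∈₃ T → x ∈ₛ set₃ T
∈set₃⁺ (a , b , c) (inj₁ refl) = x∈p∪q⁺ (inj₁ (x∈⁅x⁆ a))
∈set₃⁺ (a , b , c) (inj₂ (inj₁ refl)) = x∈p∪q⁺ (inj₂ (x∈p∪q⁺ (inj₁ (x∈⁅x⁆ b))))
∈set₃⁺ (a , b , c) (inj₂ (inj₂ refl)) = x∈p∪q⁺ (inj₂ (x∈p∪q⁺ (inj₂ (x∈⁅x⁆ c))))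

∈set₃⁻ : ∀ {n} (T : Fin n × Fin n × Fin n) {x} → x ∈ₛ set₃ T → x ∈₃ T
∈set₃⁻ (a , b , c) x∈ with x∈p∪q⁻ ⁅ a ⁆ _ x∈
... | inj₁ x∈a = inj₁ (x∈⁅y⁆⇒x≡y a x∈a)
... | inj₂ x∈bc with x∈p∪q⁻ ⁅ b ⁆ ⁅ c ⁆ x∈bc
...   | inj₁ x∈b = inj₂ (inj₁ (x∈⁅y⁆⇒x≡y b x∈b))
...   | inj₂ x∈c = inj₂ (inj₂ (x∈⁅y⁆⇒x≡y c x∈c))

∣⁅x⁆∪p∣ : ∀ {n} (x : Fin n) (p : Subset n) → x ∉ₛ p → ∣ ⁅ x ⁆ ∪ p ∣ ≡ suc ∣ p ∣
∣⁅x⁆∪p∣ fzero (inside ∷ p) x∉p = ⊥-elim (x∉p here)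
∣⁅x⁆∪p∣ fzero (outside ∷ p) _ = cong (suc ∘ ∣_∣) (∪-identityˡ p)
∣⁅x⁆∪p∣ (fsuc x) (inside ∷ p) x∉p = cong suc (∣⁅x⁆∪p∣ x p (x∉p ∘ there))
∣⁅x⁆∪p∣ (fsuc x) (outside ∷ p) x∉p = ∣⁅x⁆∪p∣ x p (x∉p ∘ there)

∣set₃∣ : ∀ {n} (T : Fin n × Fin n × Fin n) → Distinct T → ∣ set₃ T ∣ ≡ 3
∣set₃∣ (a , b , c) (a≢b , a≢c , b≢c) = begin
  ∣ ⁅ a ⁆ ∪ ⁅ b ⁆ ∪ ⁅ c ⁆ ∣ ≡⟨ ∣⁅x⁆∪p∣ a _ a∉bc ⟩
  suc ∣ ⁅ b ⁆ ∪ ⁅ c ⁆ ∣     ≡⟨ cong suc (∣⁅x⁆∪p∣ b ⁅ c ⁆ (x≢y⇒x∉⁅y⁆ b≢c)) ⟩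
  suc (suc ∣ ⁅ c ⁆ ∣)       ≡⟨ cong (suc ∘ suc) (∣⁅x⁆∣≡1 c) ⟩
  3                         ∎
  where
  open ≡-Reasoning
  a∉bc : a ∉ₛ ⁅ b ⁆ ∪ ⁅ c ⁆
  a∉bc a∈ with x∈p∪q⁻ ⁅ b ⁆ ⁅ c ⁆ a∈
  ... | inj₁ a∈b = a≢b (x∈⁅y⁆⇒x≡y b a∈b)
  ... | inj₂ a∈c = a≢c (x∈⁅y⁆⇒x≡y c a∈c)

module _ {A : Set} (R : A → A → A → Set)
         (swap₁₂ : ∀ {x y z} → R x y z → R y x z)
         (swap₂₃ : ∀ {x y z} → R x y z → R x z y) where

  permute : ∀ {a b c x y z} → R a b c → x ∈₃ (a , b , c) → y ∈₃ (a , b , c) → z ∈₃ (a , b , c) →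
            x ≢ y → x ≢ z → y ≢ z → R x y z
  permute r (inj₁ refl) (inj₂ (inj₁ refl)) (inj₂ (inj₂ refl)) _ _ _ = r
  permute r (inj₁ refl) (inj₂ (inj₂ refl)) (inj₂ (inj₁ refl)) _ _ _ = swap₂₃ r
  permute r (inj₂ (inj₁ refl)) (inj₁ refl) (inj₂ (inj₂ refl)) _ _ _ = swap₁₂ r
  permute r (inj₂ (inj₁ refl)) (inj₂ (inj₂ refl)) (inj₁ refl) _ _ _ = swap₂₃ (swap₁₂ r)
  permute r (inj₂ (inj₂ refl)) (inj₁ refl) (inj₂ (inj₁ refl)) _ _ _ = swap₁₂ (swap₂₃ r)
  permute r (inj₂ (inj₂ refl)) (inj₂ (inj₁ refl)) (inj₁ refl) _ _ _ = swap₁₂ (swap₂₃ (swap₁₂ r))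
  permute r (inj₁ refl) (inj₁ refl) _ x≢y _ _ = ⊥-elim (x≢y refl)
  permute r (inj₂ (inj₁ refl)) (inj₂ (inj₁ refl)) _ x≢y _ _ = ⊥-elim (x≢y refl)
  permute r (inj₂ (inj₂ refl)) (inj₂ (inj₂ refl)) _ x≢y _ _ = ⊥-elim (x≢y refl)
  permute r (inj₁ refl) _ (inj₁ refl) _ x≢z _ = ⊥-elim (x≢z refl)
  permute r (inj₂ (inj₁ refl)) _ (inj₂ (inj₁ refl)) _ x≢z _ = ⊥-elim (x≢z refl)
  permute r (inj₂ (inj₂ refl)) _ (inj₂ (inj₂ refl)) _ x≢z _ = ⊥-elim (x≢z refl)
  permute r _ (inj₁ refl) (inj₁ refl) _ _ y≢z = ⊥-elim (y≢z refl)
  permute r _ (inj₂ (inj₁ refl)) (inj₂ (inj₁ refl)) _ _ y≢z = ⊥-elim (y≢z refl)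
  permute r _ (inj₂ (inj₂ refl)) (inj₂ (inj₂ refl)) _ _ y≢z = ⊥-elim (y≢z refl)

three-bools : ∀ {b c d : Bool} → b ≢ c → c ≢ d → b ≢ d → ⊥
three-bools {d = d} b≢c c≢d b≢d =
  b≢d (trans (¬-not b≢c) (trans (cong not (¬-not c≢d)) (not-involutive d)))

module Construction (m : ℕ) (3≤m : 3 ≤ m) where

  -- the cyclic successor of a block; m ≥ 3 rules out periods 1 and 2
  next : Fin m → Fin m
  next = sucMod

  next-≢ : ∀ p → next p ≢ p
  next-≢ p = shift-≢ 1 p (s≤s z≤n) (≤-trans (s≤s (s≤s z≤n)) 3≤m)

  next²-≢ : ∀ p → next (next p) ≢ p
  next²-≢ p = shift-≢ 2 p (s≤s z≤n) 3≤m

  data Vertex : Set where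
    apex  : Vertex
    ⟨_,_⟩ : Fin m → Bool → Vertex

  ⟨⟩-injective : ∀ {p q b c} → ⟨ p , b ⟩ ≡ ⟨ q , c ⟩ → p ≡ q × b ≡ c
  ⟨⟩-injective refl = refl , refl

  isApex? : ∀ x → Dec (x ≡ apex)
  isApex? apex = yes refl
  isApex? ⟨ _ , _ ⟩ = no λ ()

  N : ℕ
  N = suc (m + m)

  encode : Vertex → Fin N
  encode apex = fzero
  encode ⟨ p , false ⟩ = fsuc (p ↑ˡ m)
  encode ⟨ p , true ⟩ = fsuc (m ↑ʳ p)

  decode : Fin N → Vertex
  decode fzero = apex
  decode (fsuc y) = [ (λ p → ⟨ p , false ⟩) , (λ p → ⟨ p , true ⟩) ]′ (splitAt m y)

  decode-encode : ∀ x → decode (encode x) ≡ x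
  decode-encode apex = refl
  decode-encode ⟨ p , false ⟩ rewrite splitAt-↑ˡ m p m = refl
  decode-encode ⟨ p , true ⟩ rewrite splitAt-↑ʳ m m p = refl

  encode-decode : ∀ y → encode (decode y) ≡ y
  encode-decode fzero = refl
  encode-decode (fsuc y) with splitAt m y in eq
  ... | inj₁ p = cong fsuc (splitAt⁻¹-↑ˡ eq)
  ... | inj₂ p = cong fsuc (splitAt⁻¹-↑ʳ eq)

  encode-injective : Injective _≡_ _≡_ encode
  encode-injective {x} {x′} e = trans (sym (decode-encode x)) (trans (cong decode e) (decode-encode x′))

  decode-injective : Injective _≡_ _≡_ decode
  decode-injective {y} {y′} e = trans (sym (encode-decode y)) (trans (cong encode e) (encode-decode y′))

  -- Shape x y z: the ordered triple (x, y, z) is a fan whose apex sits at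
  -- position k (apexₖ), or a ladder ⟨p,·⟩,⟨p,·⟩,⟨p+1,·⟩ whose upper vertex
  -- sits at position k (ladderₖ).
  data Shape : Vertex → Vertex → Vertex → Set where
    apex₀   : ∀ {p q b c} → p ≢ q → Shape apex ⟨ p , b ⟩ ⟨ q , c ⟩
    apex₁   : ∀ {p q b c} → p ≢ q → Shape ⟨ p , b ⟩ apex ⟨ q , c ⟩
    apex₂   : ∀ {p q b c} → p ≢ q → Shape ⟨ p , b ⟩ ⟨ q , c ⟩ apex
    ladder₀ : ∀ {p q b c d} → q ≡ next p → b ≢ c → Shape ⟨ q , d ⟩ ⟨ p , b ⟩ ⟨ p , c ⟩
    ladder₁ : ∀ {p q b c d} → q ≡ next p → b ≢ c → Shape ⟨ p , b ⟩ ⟨ q , d ⟩ ⟨ p , c ⟩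
    ladder₂ : ∀ {p q b c d} → q ≡ next p → b ≢ c → Shape ⟨ p , b ⟩ ⟨ p , c ⟩ ⟨ q , d ⟩

  swap₁₂ : ∀ {x y z} → Shape x y z → Shape y x z
  swap₁₂ (apex₀ p≢q) = apex₁ p≢q
  swap₁₂ (apex₁ p≢q) = apex₀ p≢q
  swap₁₂ (apex₂ p≢q) = apex₂ (p≢q ∘ sym)
  swap₁₂ (ladder₀ e b≢c) = ladder₁ e b≢c
  swap₁₂ (ladder₁ e b≢c) = ladder₀ e b≢c
  swap₁₂ (ladder₂ e b≢c) = ladder₂ e (b≢c ∘ sym)

  swap₂₃ : ∀ {x y z} → Shape x y z → Shape x z y
  swap₂₃ (apex₀ p≢q) = apex₀ (p≢q ∘ sym)
  swap₂₃ (apex₁ p≢q) = apex₂ p≢q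
  swap₂₃ (apex₂ p≢q) = apex₁ p≢q
  swap₂₃ (ladder₀ e b≢c) = ladder₀ e (b≢c ∘ sym)
  swap₂₃ (ladder₁ e b≢c) = ladder₂ e b≢c
  swap₂₃ (ladder₂ e b≢c) = ladder₁ e b≢c

  apexSeparates : ∀ {p q b c} → Shape ⟨ p , b ⟩ apex ⟨ q , c ⟩ → p ≢ q
  apexSeparates (apex₁ p≢q) = p≢q

  sameBlockWindow : ∀ {p b c t} → Shape ⟨ p , b ⟩ ⟨ p , c ⟩ t → ∃ λ d → t ≡ ⟨ next p , d ⟩
  sameBlockWindow (apex₂ p≢p) = ⊥-elim (p≢p refl)
  sameBlockWindow (ladder₀ p≡p+1 _) = ⊥-elim (next-≢ _ (sym p≡p+1))
  sameBlockWindow (ladder₁ p≡p+1 _) = ⊥-elim (next-≢ _ (sym p≡p+1))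
  sameBlockWindow (ladder₂ refl _) = _ , refl

  -- The key step: after a ladder on block p containing ⟨p,b⟩, a window that
  -- keeps ⟨p,c⟩ and the upper vertex ⟨p+1,d⟩ but not ⟨p,b⟩ is a fan closed
  -- by the apex; as a ladder it would need a third vertex of block p, or
  -- p + 2 = p, or p + 1 = p.
  closesAtApex : ∀ {p q b c d t} → q ≡ next p → b ≢ c →
                 Shape ⟨ p , c ⟩ ⟨ q , d ⟩ t → ⟨ p , b ⟩ ≢ t → t ≡ apex
  closesAtApex _ _ (apex₂ _) _ = refl
  closesAtApex q≡p+1 _ (ladder₀ p≡q+1 _) _ = ⊥-elim (next²-≢ _ (trans (cong next (sym q≡p+1)) (sym p≡q+1)))
  closesAtApex _ b≢c (ladder₁ _ c≢c′) b≢t = ⊥-elim (three-bools b≢c c≢c′ (b≢t ∘ cong ⟨ _ ,_⟩))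
  closesAtApex p≡p+1 _ (ladder₂ _ _) _ = ⊥-elim (next-≢ _ (sym p≡p+1))

  noApexRun : ∀ {a₀ a₁ a₂ a₃ a₄} →
              Shape a₀ a₁ a₂ → Shape a₁ a₂ a₃ → Shape a₂ a₃ a₄ → a₀ ≢ a₃ → a₁ ≢ a₄ →
              a₀ ≢ apex → a₁ ≢ apex → a₂ ≢ apex → a₃ ≢ apex → a₄ ≢ apex → ⊥
  noApexRun (apex₀ _) _ _ _ _ a₀≢apex _ _ _ _ = a₀≢apex refl
  noApexRun (apex₁ _) _ _ _ _ _ a₁≢apex _ _ _ = a₁≢apex refl
  noApexRun (apex₂ _) _ _ _ _ _ _ a₂≢apex _ _ = a₂≢apex refl
  noApexRun (ladder₀ _ b≢c) S₁ S₂ _ a₁≢a₄ _ _ _ _ a₄≢apex with sameBlockWindow S₁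
  ... | _ , refl = a₄≢apex (closesAtApex refl b≢c S₂ a₁≢a₄)
  noApexRun (ladder₁ e b≢c) S₁ _ a₀≢a₃ _ _ _ _ a₃≢apex _ = a₃≢apex (closesAtApex e b≢c (swap₁₂ S₁) a₀≢a₃)
  noApexRun (ladder₂ e b≢c) S₁ _ a₀≢a₃ _ _ _ _ a₃≢apex _ = a₃≢apex (closesAtApex e b≢c S₁ a₀≢a₃)

  -- Nor can the windows leaving the apex return to it: the window through the
  -- apex on the way back would contain two vertices of one block (after four
  -- steps if the first ladder is ladder₁, after five if it is ladder₀).
  apexRun : ∀ {x y w t s} →
            Shape apex x y → Shape x y w → Shape y w t → Shape w t s →
            w ≢ apex → x ≢ t → y ≢ s →
            (t ≡ apex → Shape w apex x) → (s ≡ apex → Shape t apex x) → ⊥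
  apexRun (apex₀ _) (apex₂ _) _ _ w≢apex _ _ _ _ = w≢apex refl
  apexRun (apex₀ p≢p) (ladder₂ _ _) _ _ _ _ _ _ _ = p≢p refl
  apexRun (apex₀ _) (ladder₁ e b≢c) S₂ _ _ x≢t _ back₄ _ =
    apexSeparates (back₄ (closesAtApex e b≢c (swap₁₂ S₂) x≢t)) refl
  apexRun (apex₀ _) (ladder₀ e b≢c) S₂ S₃ _ _ y≢s _ back₅ with sameBlockWindow S₂
  ... | _ , refl = apexSeparates (back₅ (closesAtApex refl b≢c S₃ y≢s)) (sym e)

  -- Edges are coded by (p, q, b): for p = q the ladder on block p whose upper
  -- vertex is ⟨p + 1, b⟩; for p ≠ q the fan through ⟨p,b⟩ and block q, the
  -- bit of the second vertex being flipped when p < q.  For p < q the codes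
  -- (p,q,·) and (q,p,·) thus give all four fans on blocks p and q.
  Code : Set
  Code = Fin m × Fin m × Bool

  flipIfBelow : ∀ {p q : Fin m} → Tri (p F.< q) (p ≡ q) (q F.< p) → Bool → Bool
  flipIfBelow (tri< _ _ _) b = not b
  flipIfBelow (tri≈ _ _ _) b = b
  flipIfBelow (tri> _ _ _) b = b

  partner : Fin m → Fin m → Bool → Bool
  partner p q = flipIfBelow (<-cmp p q)

  -- orienting from both ends flips the bit, so (p,q,·) and (q,p,·) never collide
  partner-swap : ∀ {p q} b → p ≢ q → partner q p (partner p q b) ≢ b
  partner-swap {p} {q} b p≢q with <-cmp p q | <-cmp q p
  ... | tri≈ _ p≡q _ | _ = ⊥-elim (p≢q p≡q)
  ... | _ | tri≈ _ q≡p _ = ⊥-elim (p≢q (sym q≡p))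
  ... | tri< p<q _ _ | tri< q<p _ _ = ⊥-elim (<-asym p<q q<p)
  ... | tri> _ _ p>q | tri> _ _ q>p = ⊥-elim (<-asym p>q q>p)
  ... | tri< _ _ _ | tri> _ _ _ = not-¬ refl ∘ sym
  ... | tri> _ _ _ | tri< _ _ _ = not-¬ refl ∘ sym

  ladder : Fin m → Bool → Vertex × Vertex × Vertex
  ladder p b = ⟨ p , false ⟩ , ⟨ p , true ⟩ , ⟨ next p , b ⟩

  fan : Fin m → Fin m → Bool → Vertex × Vertex × Vertex
  fan p q b = apex , ⟨ p , b ⟩ , ⟨ q , partner p q b ⟩

  edgeTriple : Code → Vertex × Vertex × Vertex
  edgeTriple (p , q , b) with p ≟ q
  ... | yes _ = ladder p b
  ... | no _ = fan p q b

  Shape₃ : Vertex × Vertex × Vertex → Set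
  Shape₃ (x , y , z) = Shape x y z

  edgeTriple-shape : ∀ c → Shape₃ (edgeTriple c)
  edgeTriple-shape (p , q , b) with p ≟ q
  ... | yes _ = ladder₂ refl λ ()
  ... | no p≢q = apex₀ p≢q

  edgeTriple-distinct : ∀ c → Distinct (edgeTriple c)
  edgeTriple-distinct (p , q , b) with p ≟ q
  ... | yes _ = (λ ()) , next-≢ p ∘ sym ∘ proj₁ ∘ ⟨⟩-injective , next-≢ p ∘ sym ∘ proj₁ ∘ ⟨⟩-injective
  ... | no p≢q = (λ ()) , (λ ()) , p≢q ∘ proj₁ ∘ ⟨⟩-injective

  -- distinct codes give distinct edges: a ladder is determined by its block
  -- pair and upper vertex, a fan by its two non-apex vertices
  ladder-injective : ∀ {p b p′ b′} → ladder p b ⊆₃ ladder p′ b′ → (p , p , b) ≡ (p′ , p′ , b′)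
  ladder-injective {p} {b} sub with sub ⟨ p , false ⟩ (inj₁ refl)
  ... | inj₂ (inj₂ refl) with sub ⟨ p , true ⟩ (inj₂ (inj₁ refl))
  ...   | inj₂ (inj₁ e) = ⊥-elim (next-≢ _ (proj₁ (⟨⟩-injective e)))
  ladder-injective {p} {b} sub | inj₁ refl with sub ⟨ next p , b ⟩ (inj₂ (inj₂ refl))
  ...   | inj₁ e = ⊥-elim (next-≢ p (proj₁ (⟨⟩-injective e)))
  ...   | inj₂ (inj₁ e) = ⊥-elim (next-≢ p (proj₁ (⟨⟩-injective e)))
  ...   | inj₂ (inj₂ refl) = refl

  fan-injective : ∀ {p q b p′ q′ b′} → p ≢ q → p′ ≢ q′ → fan p q b ⊆₃ fan p′ q′ b′ →
                  (p , q , b) ≡ (p′ , q′ , b′)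
  fan-injective {p} {q} {b} p≢q p′≢q′ sub with sub ⟨ p , b ⟩ (inj₂ (inj₁ refl))
  ... | inj₂ (inj₁ refl) with sub ⟨ q , partner p q b ⟩ (inj₂ (inj₂ refl))
  ...   | inj₂ (inj₁ e) = ⊥-elim (p≢q (sym (proj₁ (⟨⟩-injective e))))
  ...   | inj₂ (inj₂ refl) = refl
  fan-injective {p} {q} {b} p≢q p′≢q′ sub | inj₂ (inj₂ refl) with sub ⟨ q , partner p q b ⟩ (inj₂ (inj₂ refl))
  ...   | inj₂ (inj₂ e) = ⊥-elim (p≢q (sym (proj₁ (⟨⟩-injective e))))
  ...   | inj₂ (inj₁ e) with refl ← proj₁ (⟨⟩-injective e) =
    ⊥-elim (partner-swap _ p′≢q′ (proj₂ (⟨⟩-injective e)))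

  -- ladders avoid the apex while fans contain it
  edgeTriple-injective : ∀ c c′ → edgeTriple c ⊆₃ edgeTriple c′ → edgeTriple c′ ⊆₃ edgeTriple c → c ≡ c′
  edgeTriple-injective (p , q , b) (p′ , q′ , b′) sub sup with p ≟ q | p′ ≟ q′
  ... | yes refl | yes refl = ladder-injective sub
  ... | no p≢q | no p′≢q′ = fan-injective p≢q p′≢q′ sub
  ... | yes _ | no _ with sup apex (inj₁ refl)
  ...   | inj₁ ()
  ...   | inj₂ (inj₁ ())
  ...   | inj₂ (inj₂ ())
  edgeTriple-injective _ _ sub sup | no _ | yes _ with sub apex (inj₁ refl)
  ...   | inj₁ ()
  ...   | inj₂ (inj₁ ())
  ...   | inj₂ (inj₂ ())

  K : ℕ
  K = m * (m * 2)

  codeIndex : Fin K ↔ Code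
  codeIndex = ↔-trans *↔× (↔-refl ×-↔ ↔-trans *↔× (↔-refl ×-↔ 2↔Bool))

  codeOf : Fin K → Code
  codeOf = Inverse.to codeIndex

  edgeSet : Code → Subset N
  edgeSet c = set₃ (map₃ encode (edgeTriple c))

  ∈edgeSet⁻ : ∀ c {y} → y ∈ₛ edgeSet c → decode y ∈₃ edgeTriple c
  ∈edgeSet⁻ c y∈ with ∈set₃⁻ (map₃ encode (edgeTriple c)) y∈
  ... | inj₁ refl = inj₁ (decode-encode _)
  ... | inj₂ (inj₁ refl) = inj₂ (inj₁ (decode-encode _))
  ... | inj₂ (inj₂ refl) = inj₂ (inj₂ (decode-encode _))

  edgeSet-⊆ : ∀ c c′ → edgeSet c ≡ edgeSet c′ → edgeTriple c ⊆₃ edgeTriple c′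
  edgeSet-⊆ c c′ e x x∈ = subst (_∈₃ edgeTriple c′) (decode-encode x)
    (∈edgeSet⁻ c′ (subst (encode x ∈ₛ_) e (∈set₃⁺ _ (∈₃-map encode (edgeTriple c) x∈))))

  edgeSet-injective : Injective _≡_ _≡_ edgeSet
  edgeSet-injective {c} {c′} e = edgeTriple-injective c c′ (edgeSet-⊆ c c′ e) (edgeSet-⊆ c′ c (sym e))

  ∣edgeSet∣ : ∀ c → ∣ edgeSet c ∣ ≡ 3
  ∣edgeSet∣ c with edgeTriple-distinct c
  ... | x≢y , x≢z , y≢z = ∣set₃∣ _ (x≢y ∘ encode-injective , x≢z ∘ encode-injective , y≢z ∘ encode-injective)

  H : Hypergraph3 N
  H = record
    { edges    = map (edgeSet ∘ codeOf) (allFin K)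
    ; distinct = map⁺ (Injection.injective (↔⇒↣ codeIndex) ∘ edgeSet-injective) (allFin⁺ K)
    ; uniform  = uniform-H
    }
    where
    uniform-H : ∀ {e} → e ∈ₗ map (edgeSet ∘ codeOf) (allFin K) → ∣ e ∣ ≡ 3
    uniform-H e∈ with ∈-map⁻ (edgeSet ∘ codeOf) e∈
    ... | i , _ , refl = ∣edgeSet∣ (codeOf i)

  numEdges-H : numEdges H ≡ K
  numEdges-H = trans (length-map (edgeSet ∘ codeOf) (allFin K)) (length-tabulate (λ i → i))

  edgeShape : ∀ {a b c} → HasEdge H a b c → Distinct (decode a , decode b , decode c) →
              Shape (decode a) (decode b) (decode c)
  edgeShape {a} {b} {c} (e , e∈ , members) (a≢b , a≢c , b≢c) with ∈-map⁻ (edgeSet ∘ codeOf) e∈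
  ... | i , _ , refl =
    permute Shape swap₁₂ swap₂₃ (edgeTriple-shape (codeOf i)) (member (inj₁ refl))
      (member (inj₂ (inj₁ refl))) (member (inj₂ (inj₂ refl))) a≢b a≢c b≢c
    where
    member : ∀ {y} → y ∈₃ (a , b , c) → decode y ∈₃ edgeTriple (codeOf i)
    member {y} y∈ = ∈edgeSet⁻ (codeOf i) (Equivalence.from (members y) y∈)

  module NoTightCycle {ℓ : ℕ} (4≤ℓ : 4 ≤ ℓ) (v : Fin ℓ → Fin N) (v-injective : Injective _≡_ _≡_ v)
           (edge : ∀ i → HasEdge H (v i) (v (sucMod i)) (v (sucMod (sucMod i)))) where

    u : Fin ℓ → Vertex
    u = decode ∘ v

    u-injective : Injective _≡_ _≡_ u
    u-injective = v-injective ∘ decode-injective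

    apart : ∀ d i → 0 < d → d ≤ 3 → u (shift d i) ≢ u i
    apart d i 0<d d≤3 = shift-≢ d i 0<d (≤-trans (s≤s d≤3) 4≤ℓ) ∘ u-injective

    apart₁ : ∀ i → u (shift 1 i) ≢ u i
    apart₁ i = apart 1 i (s≤s z≤n) (s≤s z≤n)

    apart₂ : ∀ i → u (shift 2 i) ≢ u i
    apart₂ i = apart 2 i (s≤s z≤n) (s≤s (s≤s z≤n))

    apart₃ : ∀ i → u (shift 3 i) ≢ u i
    apart₃ i = apart 3 i (s≤s z≤n) (s≤s (s≤s (s≤s z≤n)))

    window : ∀ i → Shape (u i) (u (shift 1 i)) (u (shift 2 i))
    window i = edgeShape (edge i) (apart₁ i ∘ sym , apart₂ i ∘ sym , apart₁ (shift 1 i) ∘ sym)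

    noApex : (∀ i → u i ≢ apex) → ⊥
    noApex avoids = noApexRun (window i) (window (shift 1 i)) (window (shift 2 i))
      (apart₃ i ∘ sym) (apart₃ (shift 1 i) ∘ sym)
      (avoids i) (avoids (shift 1 i)) (avoids (shift 2 i)) (avoids (shift 3 i)) (avoids (shift 4 i))
      where
      i : Fin ℓ
      i = fromℕ< (≤-trans (s≤s z≤n) 4≤ℓ)

    throughApex : ∀ i → u i ≡ apex → ⊥
    throughApex i a₀≡apex = apexRun (subst (λ x → Shape x (a 1) (a 2)) a₀≡apex (window i))
      (window (shift 1 i)) (window (shift 2 i)) (window (shift 3 i))
      (λ a₃≡apex → apart₃ i (trans a₃≡apex (sym a₀≡apex)))
      (apart₃ (shift 1 i) ∘ sym) (apart₃ (shift 2 i) ∘ sym) (returnsAfter 3) (returnsAfter 4)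
      where
      a : ℕ → Vertex
      a n = u (shift n i)
      returnsAfter : ∀ n → a (suc n) ≡ apex → Shape (a n) apex (a 1)
      returnsAfter n back = subst (λ x → Shape (a n) x (a 1)) back
        (subst (λ j → Shape (a n) (a (suc n)) (u (sucMod j))) period (window (shift n i)))
        where
        period : shift (suc n) i ≡ i
        period = u-injective (trans back (sym a₀≡apex))

    impossible : ⊥
    impossible with any? (λ i → isApex? (u i))
    ... | yes (i , uᵢ≡apex) = throughApex i uᵢ≡apex
    ... | no none = noApex λ i uᵢ≡apex → none (i , uᵢ≡apex)

  tightCycleFree : TightCycleFree H
  tightCycleFree ℓ 4≤ℓ (v , v-injective , edge) = NoTightCycle.impossible 4≤ℓ v v-injective edge

twice-choose-2 : ∀ n → 2 * (n C 2) + n ≡ n * n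
twice-choose-2 zero = refl
twice-choose-2 (suc n) = begin
  2 * (suc n C 2) + suc n         ≡⟨ cong (λ x → 2 * x + suc n) (sym (nCk+nC[k+1]≡[n+1]C[k+1] n 1)) ⟩
  2 * (n C 1 + n C 2) + suc n     ≡⟨ cong (λ x → 2 * (x + n C 2) + suc n) (nC1≡n n) ⟩
  2 * (n + n C 2) + suc n         ≡⟨ regroup (n C 2) n ⟩
  (2 * (n C 2) + n) + (2 * n + 1) ≡⟨ cong (_+ (2 * n + 1)) (twice-choose-2 n) ⟩
  n * n + (2 * n + 1)             ≡⟨ square-suc n ⟩
  suc n * suc n                   ∎
  where
  open ≡-Reasoning
  regroup : ∀ x n → 2 * (n + x) + suc n ≡ (2 * x + n) + (2 * n + 1)
  regroup = solve-∀
  square-suc : ∀ n → n * n + (2 * n + 1) ≡ suc n * suc n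
  square-suc = solve-∀

edgeCount : ∀ m → (m + m) C 2 + (m + m) / 2 ≡ m * (m * 2)
edgeCount m = *-cancelˡ-≡ _ _ 2 (begin
  2 * ((m + m) C 2 + (m + m) / 2) ≡⟨ cong (λ x → 2 * ((m + m) C 2 + x / 2)) (double m) ⟩
  2 * ((m + m) C 2 + m * 2 / 2)   ≡⟨ cong (λ x → 2 * ((m + m) C 2 + x)) (m*n/n≡m m 2) ⟩
  2 * ((m + m) C 2 + m)           ≡⟨ distribute ((m + m) C 2) m ⟩
  2 * ((m + m) C 2) + (m + m)     ≡⟨ twice-choose-2 (m + m) ⟩
  (m + m) * (m + m)               ≡⟨ square m ⟩
  2 * (m * (m * 2))               ∎)
  where
  open ≡-Reasoning
  double : ∀ m → m + m ≡ m * 2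
  double = solve-∀
  distribute : ∀ x m → 2 * (x + m) ≡ 2 * x + (m + m)
  distribute = solve-∀
  square : ∀ m → (m + m) * (m + m) ≡ 2 * (m * (m * 2))
  square = solve-∀

odd⇒2m+1 : ∀ n → ¬ (2 ∣ n) → ∃ λ m → n ≡ suc (m + m)
odd⇒2m+1 zero odd = ⊥-elim (odd (divides 0 refl))
odd⇒2m+1 (suc zero) _ = 0 , refl
odd⇒2m+1 (suc (suc n)) odd with odd⇒2m+1 n (λ { (divides q n≡q2) → odd (divides (suc q) (cong (suc ∘ suc) n≡q2)) })
... | m , refl = suc m , cong (suc ∘ suc) (sym (+-suc m m))

half-bound : ∀ m → 7 ≤ suc (m + m) → 3 ≤ m
half-bound (suc (suc (suc m))) _ = s≤s (s≤s (s≤s z≤n))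
half-bound zero (s≤s ())
half-bound (suc zero) (s≤s (s≤s (s≤s ())))
half-bound (suc (suc zero)) (s≤s (s≤s (s≤s (s≤s (s≤s ())))))

proposition2p1 : (n : ℕ) → 7 ≤ n → ¬ (2 ∣ n) →
    Σ (Hypergraph3 n) λ H → TightCycleFree H ×
    (((n ∸ 1) C 2) + (n ∸ 1) / 2 ≤ numEdges H)
proposition2p1 n 7≤n odd with odd⇒2m+1 n odd
... | m , refl = H , tightCycleFree , ≤-reflexive (trans (edgeCount m) (sym numEdges-H))
  where open Construction m (half-bound m 7≤n)
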